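{- For each $n>0$ and all proper $\alpha_1,\dots,\alpha_{n+1},\alpha'_1,\dots,\alpha'_n\in2^\omega$ we have \[ s^{\oplus_{n+1}}_{\alpha_1,\dots,\alpha_{n+1}}\not\le_W s_{\alpha'_1}\times\dots\times s_{\alpha'_n}. \]
   Context: Cantor space $2^\omega$ carries the lexicographic order $<_{lex}$. For $\alpha\in2^\omega$, $s_\alpha\colon 2^\omega\to\{0,1\}$ is $s_\alpha(x)=0$ if $x<_{lex}\alpha$ and $s_\alpha(x)=1$ if $x\ge_{lex}\alpha$. A sequence is proper if it contains infinitely many $1$'s. $s^{\oplus_{m}}_{\alpha_1,\dots,\alpha_m}\colon(2^\omega)^m\to\{0,1\}$ is $(x_1,\dots,x_m)\mapsto s_{\alpha_1}(x_1)\oplus\dots\oplus s_{\alpha_m}(x_m)$ ($\oplus$ = addition modulo 2). The product $f_1\times\dots\times f_n$ maps $(x_1,\dots,x_n)$ to $(f_1(x_1),\dots,f_n(x_n))$. $f\le_W g$ means there are computable functionals $\Phi,\Psi$ with $f(x)=\Psi(x,g(\Phi(x)))$ for all $x$ in the domain of $f$. -}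

module Defs where

open import Data.Nat using (ℕ; zero; suc; _≤_; _<_)
open import Data.Bool using (Bool; true; false; _xor_)
open import Data.Fin using (Fin; toℕ)
open import Data.Vec using (Vec; []; _∷_; lookup; tabulate)
open import Data.Product using (Σ; ∃; _×_; _,_)
open import Data.Sum using (_⊎_)
open import Relation.Nullary using (¬_)
open import Relation.Binary.PropositionalEquality using (_≡_)

Cantor : Set
Cantor = ℕ → Bool

_<lex_ : Cantor → Cantor → Set
x <lex α = Σ ℕ λ n → (∀ m → m < n → x m ≡ α m) × (x n ≡ false) × (α n ≡ true)

Proper : Cantor → Set
Proper α = ∀ n → Σ ℕ λ m → n ≤ m × α m ≡ true

SGraph : Cantor → Cantor → Bool → Set
SGraph α x b = (b ≡ false × x <lex α) ⊎ (b ≡ true × ¬ (x <lex α))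

xorAll : ∀ {m} → (Fin m → Bool) → Bool
xorAll {zero} c = false
xorAll {suc m} c = c Data.Fin.zero xor xorAll (λ i → c (Data.Fin.suc i))

XorGraph : ∀ {m} → (Fin m → Cantor) → (Fin m → Cantor) → (Fin 1 → Bool) → Set
XorGraph {m} α x out = ∀ (c : Fin m → Bool) → (∀ i → SGraph (α i) (x i) (c i)) →
  out Data.Fin.zero ≡ xorAll c

ProdGraph : ∀ {n} → (Fin n → Cantor) → (Fin n → Cantor) → (Fin n → Bool) → Set
ProdGraph α x b = ∀ i → SGraph (α i) (x i) (b i)

-- Oracle computability: μ-recursive functions relative to k oracles
-- (elements of Cantor space); Code k n = n-ary code with k oracles.

bitℕ : Bool → ℕ
bitℕ false = 0
bitℕ true  = 1

data Code (k : ℕ) : ℕ → Set where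
  zer  : ∀ {n} → Code k n
  succ : Code k 1
  proj : ∀ {n} → Fin n → Code k n
  orc  : Fin k → Code k 1
  comp : ∀ {m n} → Code k m → Vec (Code k n) m → Code k n
  prec : ∀ {n} → Code k n → Code k (suc (suc n)) → Code k (suc n)
  mu   : ∀ {n} → Code k (suc n) → Code k n

mutual
  data Eval {k : ℕ} (O : Fin k → Cantor) : ∀ {n} → Code k n → Vec ℕ n → ℕ → Set where
    ezero : ∀ {n} {v : Vec ℕ n} → Eval O zer v 0
    esucc : ∀ {x} → Eval O succ (x ∷ []) (suc x)
    eproj : ∀ {n} {v : Vec ℕ n} (i : Fin n) → Eval O (proj i) v (lookup v i)
    eorc  : ∀ (i : Fin k) {x} → Eval O (orc i) (x ∷ []) (bitℕ (O i x))
    ecomp : ∀ {m n} {f : Code k m} {gs : Vec (Code k n) m} {v ws r} →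
            EvalVec O gs v ws → Eval O f ws r → Eval O (comp f gs) v r
    eprec0 : ∀ {n} {g : Code k n} {h} {v r} → Eval O g v r → Eval O (prec g h) (0 ∷ v) r
    eprecS : ∀ {n} {g : Code k n} {h} {x v r r'} →
             Eval O (prec g h) (x ∷ v) r → Eval O h (x ∷ r ∷ v) r' →
             Eval O (prec g h) (suc x ∷ v) r'
    emu   : ∀ {n} {f : Code k (suc n)} {v x} →
            Eval O f (x ∷ v) 0 →
            (∀ y → y < x → Σ ℕ λ r → Eval O f (y ∷ v) (suc r)) →
            Eval O (mu f) v x

  data EvalVec {k : ℕ} (O : Fin k → Cantor) {n : ℕ} : ∀ {m} → Vec (Code k n) m → Vec ℕ n → Vec ℕ m → Set where
    enil  : ∀ {v} → EvalVec O [] v []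
    econs : ∀ {m} {g : Code k n} {gs : Vec (Code k n) m} {v w ws} →
            Eval O g v w → EvalVec O gs v ws → EvalVec O (g ∷ gs) v (w ∷ ws)

-- Weihrauch reducibility for problems f :⊆ (2^ω)^k ⇉ {0,1}^a and
-- g :⊆ (2^ω)^l ⇉ {0,1}^b, given by their graphs (all total here).
-- Φ is a computable functional (2^ω)^k → (2^ω)^l, given by a code cΦ computing
-- the bit j of component i as cΦ(i, j) relative to the oracle x;
-- Ψ(x, y) is a computable functional with y ∈ {0,1}^b (finite), given by codes
-- cΨ(o) computing output bit o from inputs y relative to oracle x.

_≤W_ : ∀ {k a l b} →
       ((Fin k → Cantor) → (Fin a → Bool) → Set) →
       ((Fin l → Cantor) → (Fin b → Bool) → Set) → Set
_≤W_ {k} {a} {l} {b} F G =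
  Σ (Code k 2) λ cΦ → Σ (Fin a → Code k b) λ cΨ →
    ∀ (x : Fin k → Cantor) →
      Σ (Fin l → Cantor) λ y →
        (∀ i j → Eval x cΦ (toℕ i ∷ j ∷ []) (bitℕ (y i j)))
        × (∀ (u : Fin b → Bool) → G y u →
             Σ (Fin a → Bool) λ out →
               F x out × (∀ o → Eval x (cΨ o) (tabulate (λ t → bitℕ (u t))) (bitℕ (out o))))

{-# OPTIONS --safe #-}
-- Start from the instance x = (α₁, …, α_{n+1}), on which every s_{αᵢ} is 1, and replace its
-- coordinates one at a time by a point just below αᵢ that agrees with αᵢ on a long prefix;
-- each replacement flips the parity. Take the prefix so long that Φ and Ψ cannot see the
-- change (oracle computations only query finitely many bits). Then every coordinate of Φ x
-- that lay below α′ᵢ still does, so a correct answer u′ for the new instance only has 1s where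
-- the old answer u had them; and u′ ≠ u, since Ψ would otherwise return the old, now wrong,
-- parity. The number of 1s in the answer thus drops n + 1 times, but starts at most at n.
-- Which side of α′ᵢ a point lies on is not decidable, so these choices are made in the
-- double-negation monad, which is harmless because the goal is ⊥.
module Submission where

open import Defs
open import Data.Bool using (Bool; true; false; not; _xor_)
open import Data.Bool.Properties using (not-distribˡ-xor; not-distribʳ-xor; not-¬; ¬-not)
import Data.Bool.Properties as Bool
open import Data.Fin using (Fin; zero; suc; toℕ; fromℕ<)
open import Data.Fin.Properties using (toℕ-fromℕ<; ¬∀⟶∃¬; _≟_)
open import Data.Fin.Subset using (_∈_; _⊂_; ∣_∣)
open import Data.Fin.Subset.Properties using (∣p∣≤n; p⊂q⇒∣p∣<∣q∣)
open import Data.Nat using (ℕ; zero; suc; _≤_; _<_; _+_; _⊔_)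
import Data.Nat as ℕ
open import Data.Nat.Properties
  using (<-cmp; ≤-reflexive; ≤-trans; <⇒≤; <-≤-trans; <-irrefl; m≤m⊔n; m≤n⊔m;
         m<n⇒m<1+n; m<1+n⇒m<n∨m≡n; n<1+n; 0≢1+n; 1+n≰n; m+n≤o⇒m≤o; +-suc; +-monoʳ-≤)
open import Data.Product using (Σ; _×_; _,_; proj₁; proj₂)
open import Data.Sum using (inj₁; inj₂)
open import Data.Vec using (Vec; []; _∷_; tabulate)
open import Data.Vec.Properties using (lookup∘tabulate; []=⇒lookup; lookup⇒[]=; tabulate-cong)
open import Data.Vec.Functional using (updateAt; tail) renaming (_∷_ to _◂_)
open import Data.Vec.Functional.Properties using (updateAt-updates; updateAt-minimal)
open import Effect.Monad using (RawMonad)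
open import Function using (_∘_; const)
open import Level using (0ℓ)
open import Relation.Binary using (tri<; tri≈; tri>)
open import Relation.Binary.Definitions using (Irreflexive)
open import Relation.Binary.PropositionalEquality
  using (_≡_; _≢_; _≗_; refl; sym; trans; cong; cong-app; subst; subst₂; module ≡-Reasoning)
open import Relation.Nullary using (¬_; Dec; yes; no; contradiction; ¬¬-excluded-middle)
open import Relation.Nullary.Negation using (¬¬-Monad)

open RawMonad (¬¬-Monad {0ℓ}) using (_>>=_; return)

bitℕ-injective : ∀ {a b} → bitℕ a ≡ bitℕ b → a ≡ b
bitℕ-injective {false} {false} _ = refl
bitℕ-injective {true}  {true}  _ = refl

mutual
  Eval-deterministic : ∀ {k} {O : Fin k → Cantor} {n} {c : Code k n} {v r r′} →
                       Eval O c v r → Eval O c v r′ → r ≡ r′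
  Eval-deterministic ezero     ezero       = refl
  Eval-deterministic esucc     esucc       = refl
  Eval-deterministic (eproj i) (eproj .i)  = refl
  Eval-deterministic (eorc i)  (eorc .i)   = refl
  Eval-deterministic (ecomp ds d) (ecomp ds′ d′)
    with refl ← EvalVec-deterministic ds ds′ = Eval-deterministic d d′
  Eval-deterministic (eprec0 d) (eprec0 d′) = Eval-deterministic d d′
  Eval-deterministic (eprecS d e) (eprecS d′ e′)
    with refl ← Eval-deterministic d d′ = Eval-deterministic e e′
  Eval-deterministic (emu {x = x} d below) (emu {x = x′} d′ below′) with <-cmp x x′
  ... | tri< x<x′ _ _ = contradiction (Eval-deterministic d (proj₂ (below′ x x<x′))) 0≢1+n
  ... | tri≈ _ x≡x′ _ = x≡x′
  ... | tri> _ _ x′<x = contradiction (Eval-deterministic d′ (proj₂ (below x′ x′<x))) 0≢1+n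

  EvalVec-deterministic : ∀ {k} {O : Fin k → Cantor} {n m} {gs : Vec (Code k n) m} {v ws ws′} →
                          EvalVec O gs v ws → EvalVec O gs v ws′ → ws ≡ ws′
  EvalVec-deterministic enil enil = refl
  EvalVec-deterministic (econs d ds) (econs d′ ds′)
    with refl ← Eval-deterministic d d′ | refl ← EvalVec-deterministic ds ds′ = refl

AgreeBelow : ∀ {k} → ℕ → (Fin k → Cantor) → (Fin k → Cantor) → Set
AgreeBelow N O O′ = ∀ i m → m < N → O i m ≡ O′ i m

Locally : ∀ {k} → ((Fin k → Cantor) → Set) → (Fin k → Cantor) → Set
Locally P O = Σ ℕ λ N → ∀ O′ → AgreeBelow N O O′ → P O′

module _ {k} {O : Fin k → Cantor} where

  locally-map : ∀ {P Q : (Fin k → Cantor) → Set} →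
                (∀ {O′} → P O′ → Q O′) → Locally P O → Locally Q O
  locally-map f (N , near) = N , λ O′ agree → f (near O′ agree)

  locally-× : ∀ {P Q : (Fin k → Cantor) → Set} →
              Locally P O → Locally Q O → Locally (λ O′ → P O′ × Q O′) O
  locally-× (N , near) (M , near′) =
    N ⊔ M , λ O′ agree → near  O′ (λ i m m<N → agree i m (<-≤-trans m<N (m≤m⊔n N M)))
                       , near′ O′ (λ i m m<M → agree i m (<-≤-trans m<M (m≤n⊔m N M)))

  locally-∀< : ∀ {P : ℕ → (Fin k → Cantor) → Set} x → (∀ y → y < x → Locally (P y) O) →
               Locally (λ O′ → ∀ y → y < x → P y O′) O
  locally-∀<     zero    _     = 0 , λ _ _ _ ()
  locally-∀< {P} (suc x) local =
    locally-map below-or-at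
      (locally-× (locally-∀< x (λ y y<x → local y (m<n⇒m<1+n y<x))) (local x (n<1+n x)))
    where
    below-or-at : ∀ {O′} → (∀ y → y < x → P y O′) × P x O′ → ∀ y → y < suc x → P y O′
    below-or-at (below , at) y y<1+x with m<1+n⇒m<n∨m≡n y<1+x
    ... | inj₁ y<x  = below y y<x
    ... | inj₂ refl = at

  locally-∀ : ∀ {K} {P : Fin K → (Fin k → Cantor) → Set} → (∀ i → Locally (P i) O) →
              Locally (λ O′ → ∀ i → P i O′) O
  locally-∀ {zero}  _     = 0 , λ _ _ ()
  locally-∀ {suc K} local =
    locally-map (λ (p₀ , ps) → λ { zero → p₀ ; (suc i) → ps i })
      (locally-× (local zero) (locally-∀ (local ∘ suc)))

mutual
  Eval-locally : ∀ {k} {O : Fin k → Cantor} {n} {c : Code k n} {v r} →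
                 Eval O c v r → Locally (λ O′ → Eval O′ c v r) O
  Eval-locally ezero     = 0 , λ _ _ → ezero
  Eval-locally esucc     = 0 , λ _ _ → esucc
  Eval-locally (eproj i) = 0 , λ _ _ → eproj i
  Eval-locally (eorc i {x}) =
    suc x , λ O′ agree → subst (Eval O′ (orc i) _ ∘ bitℕ) (sym (agree i x (n<1+n x))) (eorc i)
  Eval-locally (ecomp ds d) =
    locally-map (λ (ds′ , d′) → ecomp ds′ d′) (locally-× (EvalVec-locally ds) (Eval-locally d))
  Eval-locally (eprec0 d) = locally-map eprec0 (Eval-locally d)
  Eval-locally (eprecS d e) =
    locally-map (λ (d′ , e′) → eprecS d′ e′) (locally-× (Eval-locally d) (Eval-locally e))
  Eval-locally (emu {x = x} d below) =
    locally-map (λ (d′ , below′) → emu d′ below′)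
      (locally-× (Eval-locally d) (locally-∀< x (λ y y<x → Eval-suc-locally (below y y<x))))

  Eval-suc-locally : ∀ {k} {O : Fin k → Cantor} {n} {c : Code k n} {v} →
                     Σ ℕ (Eval O c v ∘ suc) → Locally (λ O′ → Σ ℕ (Eval O′ c v ∘ suc)) O
  Eval-suc-locally (r , e) = locally-map (r ,_) (Eval-locally e)

  EvalVec-locally : ∀ {k} {O : Fin k → Cantor} {n m} {gs : Vec (Code k n) m} {v ws} →
                    EvalVec O gs v ws → Locally (λ O′ → EvalVec O′ gs v ws) O
  EvalVec-locally enil = 0 , λ _ _ → enil
  EvalVec-locally (econs d ds) =
    locally-map (λ (d′ , ds′) → econs d′ ds′) (locally-× (Eval-locally d) (EvalVec-locally ds))

<lex-irrefl : Irreflexive _≗_ _<lex_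
<lex-irrefl x≗a (m , _ , xm≡false , am≡true) =
  contradiction (trans (sym xm≡false) (trans (x≗a m) am≡true)) λ ()

<lex-open : ∀ {x a : Cantor} → x <lex a →
            Σ ℕ λ N → ∀ x′ → (∀ m → m < N → x′ m ≡ x m) → x′ <lex a
<lex-open (m , same , xm≡false , am≡true) =
  suc m , λ x′ prefix →
    m , (λ m′ m′<m → trans (prefix m′ (m<n⇒m<1+n m′<m)) (same m′ m′<m))
      , trans (prefix m (n<1+n m)) xm≡false , am≡true

proper⇒close-below : ∀ {a : Cantor} → Proper a → ∀ N →
                     Σ Cantor λ b → b <lex a × (∀ m → m < N → b m ≡ a m)
proper⇒close-below {a} proper N with proper N
... | m , N≤m , am≡true = b , (m , b-before , b-at , am≡true) , λ k k<N → b-before k (<-≤-trans k<N N≤m)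
  where
  b : Cantor
  b k with k ℕ.≟ m
  ... | yes _ = false
  ... | no  _ = a k

  b-at : b m ≡ false
  b-at with m ℕ.≟ m
  ... | yes _   = refl
  ... | no  m≢m = contradiction refl m≢m

  b-before : ∀ k → k < m → b k ≡ a k
  b-before k k<m with k ℕ.≟ m
  ... | yes k≡m = contradiction k<m (<-irrefl k≡m)
  ... | no  _   = refl

module _ {a x : Cantor} where

  SGraph-false : ∀ {b} → SGraph a x b → b ≡ false → x <lex a
  SGraph-false (inj₁ (_ , x<a))  _  = x<a
  SGraph-false (inj₂ (refl , _)) ()

  SGraph-true : ∀ {b} → SGraph a x b → b ≡ true → ¬ x <lex a
  SGraph-true (inj₁ (refl , _))  ()
  SGraph-true (inj₂ (_ , x≮a))   _  = x≮a

  SGraph-≗ : ∀ {b} → x ≗ a → SGraph a x b → b ≡ true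
  SGraph-≗ x≗a (inj₁ (_ , x<a))      = contradiction x<a (<lex-irrefl x≗a)
  SGraph-≗ _   (inj₂ (b≡true , _)) = b≡true

  SGraph-¬¬total : ¬ ¬ Σ Bool (SGraph a x)
  SGraph-¬¬total = do
    x<a? ← ¬¬-excluded-middle
    return (decide x<a?)
    where
    decide : Dec (x <lex a) → Σ Bool (SGraph a x)
    decide (yes x<a) = false , inj₁ (refl , x<a)
    decide (no  x≮a) = true  , inj₂ (refl , x≮a)

ProdGraph-¬¬total : ∀ {K} (a y : Fin K → Cantor) → ¬ ¬ Σ (Fin K → Bool) (ProdGraph a y)
ProdGraph-¬¬total {zero}  a y = return ((λ ()) , λ ())
ProdGraph-¬¬total {suc K} a y = do
  (b , b-ok) ← SGraph-¬¬total
  (u , u-ok) ← ProdGraph-¬¬total (tail a) (tail y)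
  return (b ◂ u , λ { zero → b-ok ; (suc i) → u-ok i })

xorAll-updateAt-not : ∀ {m} (c : Fin m → Bool) i → xorAll (updateAt c i not) ≡ not (xorAll c)
xorAll-updateAt-not c zero    = sym (not-distribˡ-xor (c zero) _)
xorAll-updateAt-not c (suc i) =
  trans (cong (c zero xor_) (xorAll-updateAt-not (tail c) i)) (sym (not-distribʳ-xor (c zero) _))

module _ {n} {u : Fin n → Bool} {i : Fin n} where

  ∈-tabulate⁺ : u i ≡ true → i ∈ tabulate u
  ∈-tabulate⁺ ui≡true = lookup⇒[]= i (tabulate u) (trans (lookup∘tabulate u i) ui≡true)

  ∈-tabulate⁻ : i ∈ tabulate u → u i ≡ true
  ∈-tabulate⁻ i∈u = trans (sym (lookup∘tabulate u i)) ([]=⇒lookup i∈u)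

tabulate-⊂ : ∀ {n} {u′ u : Fin n → Bool} → (∀ i → u′ i ≡ true → u i ≡ true) → ¬ u′ ≗ u →
             tabulate u′ ⊂ tabulate u
tabulate-⊂ {n} {u′} {u} u′⇒u u′≉u with ¬∀⟶∃¬ n (λ i → u′ i ≡ u i) (λ i → u′ i Bool.≟ u i) u′≉u
... | i , u′i≢ui =
  (λ {j} j∈u′ → ∈-tabulate⁺ (u′⇒u j (∈-tabulate⁻ j∈u′))) ,
  i , ∈-tabulate⁺ ui≡true , λ i∈u′ → u′i≢ui (trans (∈-tabulate⁻ i∈u′) (sym ui≡true))
  where
  ui≡true : u i ≡ true
  ui≡true = ¬-not λ ui≡false →
    let u′i≡true : u′ i ≡ true
        u′i≡true = ¬-not λ u′i≡false → u′i≢ui (trans u′i≡false (sym ui≡false))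
    in  contradiction (trans (sym (u′⇒u i u′i≡true)) ui≡false) λ ()

module Reduction {k a l} {F : (Fin k → Cantor) → (Fin a → Bool) → Set} {α′ : Fin l → Cantor}
                 (reduction : F ≤W ProdGraph α′) where

  private
    cΦ : Code k 2
    cΦ = proj₁ reduction

    cΨ : Fin a → Code k l
    cΨ = proj₁ (proj₂ reduction)

  Φ : (Fin k → Cantor) → Fin l → Cantor
  Φ x = proj₁ (proj₂ (proj₂ reduction) x)

  Φ-computes : ∀ x i j → Eval x cΦ (toℕ i ∷ j ∷ []) (bitℕ (Φ x i j))
  Φ-computes x = proj₁ (proj₂ (proj₂ (proj₂ reduction) x))

  module _ {x : Fin k → Cantor} {u : Fin l → Bool} (u-ok : ProdGraph α′ (Φ x) u) where

    private
      solution : Σ (Fin a → Bool) λ out →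
                   F x out × (∀ o → Eval x (cΨ o) (tabulate (bitℕ ∘ u)) (bitℕ (out o)))
      solution = proj₂ (proj₂ (proj₂ (proj₂ reduction) x)) u u-ok

    Ψ : Fin a → Bool
    Ψ = proj₁ solution

    Ψ-correct : F x Ψ
    Ψ-correct = proj₁ (proj₂ solution)

    Ψ-computes : ∀ o → Eval x (cΨ o) (tabulate (bitℕ ∘ u)) (bitℕ (Ψ o))
    Ψ-computes = proj₂ (proj₂ solution)

  Φ-bit-locally : ∀ x i j → Locally (λ x′ → Φ x′ i j ≡ Φ x i j) x
  Φ-bit-locally x i j =
    locally-map (λ {x′} e → bitℕ-injective (Eval-deterministic (Φ-computes x′ i j) e))
      (Eval-locally (Φ-computes x i j))

  Φ-<lex-locally : ∀ {x i} → Φ x i <lex α′ i → Locally (λ x′ → Φ x′ i <lex α′ i) x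
  Φ-<lex-locally {x} {i} Φxi<α′i with <lex-open Φxi<α′i
  ... | N , stays-below = locally-map (stays-below _) (locally-∀< N λ j _ → Φ-bit-locally x i j)

  answers-shrink : ∀ {x u} → ProdGraph α′ (Φ x) u →
                   Locally (λ x′ → ∀ {u′} → ProdGraph α′ (Φ x′) u′ → ∀ i → u′ i ≡ true → u i ≡ true) x
  answers-shrink {x} {u} u-ok = locally-map keeps-0s (locally-∀ zero-stays-below)
    where
    zero-stays-below : ∀ i → Locally (λ x′ → u i ≡ false → Φ x′ i <lex α′ i) x
    zero-stays-below i with u i in ui
    ... | true  = 0 , λ _ _ ()
    ... | false = locally-map const (Φ-<lex-locally (SGraph-false (u-ok i) ui))

    keeps-0s : ∀ {x′} → (∀ i → u i ≡ false → Φ x′ i <lex α′ i) →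
               ∀ {u′} → ProdGraph α′ (Φ x′) u′ → ∀ i → u′ i ≡ true → u i ≡ true
    keeps-0s below u′-ok i u′i≡true =
      ¬-not λ ui≡false → SGraph-true (u′-ok i) u′i≡true (below i ui≡false)

  Ψ-locally : ∀ {x u} (u-ok : ProdGraph α′ (Φ x) u) →
              Locally (λ x′ → ∀ {u′} (u′-ok : ProdGraph α′ (Φ x′) u′) → u′ ≗ u → Ψ u′-ok ≗ Ψ u-ok) x
  Ψ-locally {x} {u} u-ok = locally-map same-output (locally-∀ λ o → Eval-locally (Ψ-computes u-ok o))
    where
    same-output : ∀ {x′} → (∀ o → Eval x′ (cΨ o) (tabulate (bitℕ ∘ u)) (bitℕ (Ψ u-ok o))) →
                  ∀ {u′} (u′-ok : ProdGraph α′ (Φ x′) u′) → u′ ≗ u → Ψ u′-ok ≗ Ψ u-ok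
    same-output {x′} computes {u′} u′-ok u′≗u o =
      bitℕ-injective
        (Eval-deterministic (subst (λ w → Eval x′ (cΨ o) w _) same-input (Ψ-computes u′-ok o)) (computes o))
      where
      same-input : tabulate (bitℕ ∘ u′) ≡ tabulate (bitℕ ∘ u)
      same-input = tabulate-cong (cong bitℕ ∘ u′≗u)

module XorStages {m l} {α : Fin m → Cantor} {α′ : Fin l → Cantor} (α-proper : ∀ i → Proper (α i))
                 (reduction : XorGraph α ≤W ProdGraph α′) where

  open Reduction reduction

  record Perturbation (x : Fin m → Cantor) (c : Fin m → Bool) (u : Fin l → Bool) (i : Fin m) : Set where
    field
      x′           : Fin m → Cantor
      x′-elsewhere : ∀ i′ → i′ ≢ i → x′ i′ ≡ x i′
      x′-signs     : ∀ i′ → SGraph (α i′) (x′ i′) (updateAt c i not i′)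
      x′-answers   : ∀ {u′} → ProdGraph α′ (Φ x′) u′ → tabulate u′ ⊂ tabulate u

  perturb : ∀ {x c u} → (∀ i → SGraph (α i) (x i) (c i)) → ProdGraph α′ (Φ x) u → ∀ i → x i ≗ α i →
            Perturbation x c u i
  perturb {x} {c} {u} c-ok u-ok i x≗α with locally-× (answers-shrink u-ok) (Ψ-locally u-ok)
  ... | N , near with proper⇒close-below (α-proper i) N
  ... | b , b<α , b≈α = record
    { x′ = x′ ; x′-elsewhere = x′-elsewhere ; x′-signs = x′-signs ; x′-answers = x′-answers }
    where
    x′ : Fin m → Cantor
    x′ = updateAt x i (const b)

    x′-at : x′ i ≡ b
    x′-at = updateAt-updates i x

    x′-elsewhere : ∀ i′ → i′ ≢ i → x′ i′ ≡ x i′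
    x′-elsewhere i′ = updateAt-minimal i′ i x

    x′-near : AgreeBelow N x x′
    x′-near i′ j j<N with i′ ≟ i
    ... | yes refl = sym (trans (cong-app x′-at j) (trans (b≈α j j<N) (sym (x≗α j))))
    ... | no  i′≢i = sym (cong-app (x′-elsewhere i′ i′≢i) j)

    x′-signs : ∀ i′ → SGraph (α i′) (x′ i′) (updateAt c i not i′)
    x′-signs i′ with i′ ≟ i
    ... | yes refl = subst₂ (SGraph (α i)) (sym x′-at) (sym c′-at) (inj₁ (refl , b<α))
      where
      c′-at : updateAt c i not i ≡ false
      c′-at = trans (updateAt-updates i c) (cong not (SGraph-≗ x≗α (c-ok i)))
    ... | no  i′≢i =
      subst₂ (SGraph (α i′)) (sym (x′-elsewhere i′ i′≢i)) (sym (updateAt-minimal i′ i c i′≢i)) (c-ok i′)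

    parity-flipped : ∀ {u′} (u′-ok : ProdGraph α′ (Φ x′) u′) → Ψ u′-ok zero ≢ Ψ u-ok zero
    parity-flipped u′-ok same-parity = not-¬ refl (begin
      xorAll c                  ≡⟨ sym (Ψ-correct u-ok c c-ok) ⟩
      Ψ u-ok zero               ≡⟨ sym same-parity ⟩
      Ψ u′-ok zero              ≡⟨ Ψ-correct u′-ok _ x′-signs ⟩
      xorAll (updateAt c i not) ≡⟨ xorAll-updateAt-not c i ⟩
      not (xorAll c)            ∎)
      where open ≡-Reasoning

    x′-answers : ∀ {u′} → ProdGraph α′ (Φ x′) u′ → tabulate u′ ⊂ tabulate u
    x′-answers u′-ok with near x′ x′-near
    ... | shrinks , same-Ψ =
      tabulate-⊂ (shrinks u′-ok) (λ u′≗u → parity-flipped u′-ok (same-Ψ u′-ok u′≗u zero))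

  record Stage (j : ℕ) : Set where
    field
      point          : Fin m → Cantor
      signs          : Fin m → Bool
      signs-correct  : ∀ i → SGraph (α i) (point i) (signs i)
      untouched      : ∀ i → j ≤ toℕ i → point i ≗ α i
      answer         : Fin l → Bool
      answer-correct : ProdGraph α′ (Φ point) answer
      budget         : j + ∣ tabulate answer ∣ ≤ l

  initial-stage : ¬ ¬ Stage 0
  initial-stage = do
    (u , u-ok) ← ProdGraph-¬¬total α′ (Φ α)
    return record
      { point = α ; signs = const true ; signs-correct = λ i → inj₂ (refl , <lex-irrefl λ _ → refl)
      ; untouched = λ _ _ _ → refl ; answer = u ; answer-correct = u-ok ; budget = ∣p∣≤n (tabulate u) }

  next-stage : ∀ {j} → Stage j → j < m → ¬ ¬ Stage (suc j)
  next-stage {j} s j<m = do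
    (u′ , u′-ok) ← ProdGraph-¬¬total α′ (Φ x′)
    return record
      { point = x′ ; signs = updateAt signs i not ; signs-correct = x′-signs
      ; untouched = x′-untouched ; answer = u′ ; answer-correct = u′-ok
      ; budget = subst (_≤ l) (+-suc j _)
                       (≤-trans (+-monoʳ-≤ j (p⊂q⇒∣p∣<∣q∣ (x′-answers u′-ok))) budget) }
    where
    open Stage s
    i : Fin m
    i = fromℕ< j<m
    open Perturbation
      (perturb signs-correct answer-correct i (untouched i (≤-reflexive (sym (toℕ-fromℕ< j<m)))))

    x′-untouched : ∀ i′ → suc j ≤ toℕ i′ → x′ i′ ≗ α i′
    x′-untouched i′ j<i′ k = trans (cong-app (x′-elsewhere i′ i′≢i) k) (untouched i′ (<⇒≤ j<i′) k)
      where
      i′≢i : i′ ≢ i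
      i′≢i refl = <-irrefl (sym (toℕ-fromℕ< j<m)) j<i′

  stages : ∀ j → j ≤ m → ¬ ¬ Stage j
  stages zero    _   = initial-stage
  stages (suc j) j<m = stages j (<⇒≤ j<m) >>= λ s → next-stage s j<m

  no-stage-beyond-budget : ¬ Stage (suc l)
  no-stage-beyond-budget s = 1+n≰n (m+n≤o⇒m≤o (suc l) (Stage.budget s))

xor≰Wproduct : ∀ {m l} {α : Fin m → Cantor} {α′ : Fin l → Cantor} → l < m → (∀ i → Proper (α i)) →
               ¬ (XorGraph α ≤W ProdGraph α′)
xor≰Wproduct {l = l} l<m α-proper reduction =
  stages (suc l) l<m no-stage-beyond-budget
  where open XorStages α-proper reduction

mainTheorem3 : (n : ℕ) → 0 < n →
    (α : Fin (suc n) → Cantor) → (α′ : Fin n → Cantor) →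
    (∀ i → Proper (α i)) → (∀ i → Proper (α′ i)) →
    ¬ (XorGraph α ≤W ProdGraph α′)
mainTheorem3 n _ α α′ α-proper _ = xor≰Wproduct (n<1+n n) α-proper
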